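{- For every $n\ge1$, the labeling $\lambda_{\bullet_2}$ is an EL-labeling of $\Pi_n^\bullet$. Consequently, $\Pi_n^\bullet$ is EL-shellable and its maximal intervals are Cohen–Macaulay.
   Context: A pointed set is a pair $(A,p)$, written $A^p$, with $A$ nonempty finite and $p\in A$. A pointed partition of $[n]$ is a collection of pointed sets whose underlying sets form a set partition of $[n]$. In $\Pi_n^\bullet$, $\pi\lessdot\pi'$ exactly when $\pi'$ is obtained from $\pi$ by replacing two blocks $A^p,B^q$ (with $\min A<\min B$) by $(A\cup B)^p$ (a $1$-merge) or $(A\cup B)^q$ (a $0$-merge), other blocks unchanged. The labeling $\lambda_{\bullet_2}$ assigns to a $u$-merge the label $(\min A,\min B)^u$, regarded as an element of the poset $\Lambda_n^w$: for $a\in[n-1]$ let $\Gamma_a=\{(a,b)^u:a<b\le n,u\in\{0,1\}\}$ ordered by $(a,b)^u\le(a,c)^v$ iff $b\le c$ and $u\le v$, and $\Lambda_n^w=\Gamma_1\oplus\cdots\oplus\Gamma_{n-1}$ (ordinal sum: elements of $\Gamma_a$ lie below elements of $\Gamma_{a'}$ when $a<a'$). An edge labeling is an EL-labeling if every closed interval $[x,y]$ has a unique increasing maximal chain (consecutive labels strictly increasing) and this chain's label sequence lexicographically precedes that of every other maximal chain of $[x,y]$ (i.e., at the first position where the sequences differ, the label of the increasing chain is strictly smaller). Maximal intervals are intervals $[\hat0,m]$ with $m$ maximal. -}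

module Defs where

open import Data.Nat using (ℕ)
open import Data.Fin using (Fin; _<_; _≤_; _≟_)
open import Data.Bool using (Bool; true; false; if_then_else_)
import Data.Bool as B
open import Data.Vec using (Vec; lookup; tabulate)
open import Data.List using (List; []; _∷_; _++_; map)
open import Data.Product using (Σ; ∃; ∃-syntax; _×_; _,_; proj₁)
open import Data.Sum using (_⊎_)
open import Data.Unit using (⊤)
open import Relation.Nullary using (¬_; does)
open import Relation.Binary.PropositionalEquality using (_≡_; _≢_)

-- A pointed partition π is encoded by the vector x : Vec (Fin n) n with
-- x[i] = the point of the block of π containing i.  Blocks are the
-- fibres of x, the point of a block is its (unique) fixed point.
-- Valid encodings are exactly the idempotent maps; this is a bijection
-- between pointed partitions of [n] and idempotent maps [n] → [n].

Raw : ℕ → Set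
Raw n = Vec (Fin n) n

IsPointedPartition : ∀ {n} → Raw n → Set
IsPointedPartition {n} x = ∀ (i : Fin n) → lookup x (lookup x i) ≡ lookup x i

IsPoint : ∀ {n} → Raw n → Fin n → Set
IsPoint x p = lookup x p ≡ p

IsMinOfBlock : ∀ {n} → Raw n → Fin n → Fin n → Set
IsMinOfBlock {n} x p a = lookup x a ≡ p × (∀ (j : Fin n) → lookup x j ≡ p → a ≤ j)

-- Replace the blocks with points p (block P) and q (block Q) by (P ∪ Q)^p.
merge : ∀ {n} → Raw n → Fin n → Fin n → Raw n
merge x p q = tabulate (λ i → if does (lookup x i ≟ q) then p else lookup x i)

-- Labels: (a , b , u) stands for (a,b)^u, with u = true meaning 1.

Label : ℕ → Set
Label n = Fin n × Fin n × Bool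

_≤Λ_ : ∀ {n} → Label n → Label n → Set
(a , b , u) ≤Λ (a' , b' , v) = (a < a') ⊎ (a ≡ a' × b ≤ b' × u B.≤ v)

_<Λ_ : ∀ {n} → Label n → Label n → Set
l <Λ l' = l ≤Λ l' × l ≢ l'

-- Merge the blocks with points p, q (mins a, b); the merged block gets
-- point p.  If a < b this is a 1-merge of A = block p, B = block q, label
-- (a,b)^1; if b < a it is a 0-merge of A = block q, B = block p, label (b,a)^0.

LCover : ∀ {n} → Raw n → Label n → Raw n → Set
LCover {n} x ℓ y =
  Σ (Fin n) λ p → Σ (Fin n) λ q → Σ (Fin n) λ a → Σ (Fin n) λ b →
    IsPoint x p × IsPoint x q × p ≢ q ×
    IsMinOfBlock x p a × IsMinOfBlock x q b ×
    y ≡ merge x p q ×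
    ((a < b × ℓ ≡ (a , b , true)) ⊎ (b < a × ℓ ≡ (b , a , false)))

-- A maximal chain of the interval [x, y]: a saturated chain
-- x = z₀ ⋖ z₁ ⋖ ... ⋖ z_k = y, recorded as the list of (label, z_i), i ≥ 1.
Steps : ℕ → Set
Steps n = List (Label n × Raw n)

IsMaxChain : ∀ {n} → Raw n → Raw n → Steps n → Set
IsMaxChain x y [] = x ≡ y
IsMaxChain x y ((ℓ , z) ∷ s) = LCover x ℓ z × IsMaxChain z y s

labels : ∀ {n} → Steps n → List (Label n)
labels = map proj₁

_≤Π_ : ∀ {n} → Raw n → Raw n → Set
x ≤Π y = ∃[ s ] IsMaxChain x y s

Increasing : ∀ {n} → List (Label n) → Set
Increasing [] = ⊤
Increasing (l ∷ []) = ⊤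
Increasing (l ∷ l' ∷ ls) = l <Λ l' × Increasing (l' ∷ ls)

LexPrecedes : ∀ {n} → List (Label n) → List (Label n) → Set
LexPrecedes {n} ls ls' =
  Σ (List (Label n)) λ pre → Σ (Label n) λ l → Σ (Label n) λ l' →
  Σ (List (Label n)) λ r → Σ (List (Label n)) λ r' →
    ls ≡ pre ++ (l ∷ r) × ls' ≡ pre ++ (l' ∷ r') × l <Λ l'

IsELLabeling•₂ : ℕ → Set
IsELLabeling•₂ n =
  ∀ (x y : Raw n) → IsPointedPartition x → x ≤Π y →
    Σ (Steps n) λ c →
      IsMaxChain x y c × Increasing (labels c) ×
      (∀ (c' : Steps n) → IsMaxChain x y c' → Increasing (labels c') → c' ≡ c) ×
      (∀ (c' : Steps n) → IsMaxChain x y c' → c' ≢ c → LexPrecedes (labels c) (labels c'))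

-- Let x < y be pointed partitions, m₁ the least element whose y-block is not an x-block, and m₂ the
-- least element of that y-block outside the x-block of m₁; let u = 1 exactly when the point of this
-- y-block already is the point of the x-block of m₁. Every cover x ⋖ z ≤ y is labelled at least
-- (m₁,m₂)ᵘ, with equality only for the merge z₀ of the x-blocks of m₁ and m₂, and every cover
-- z₀ ⋖ w ≤ y is labelled strictly above (m₁,m₂)ᵘ. An increasing chain from x to y cannot start above
-- (m₁,m₂)ᵘ either: some step merges the blocks of m₁ and m₂, so the first label is at most (m₁,m₂)¹,
-- and if u = 0 some step is a 0-merge moving the point of the block of m₁, labelled (m₁,d)⁰.
-- Induction on the number of blocks then yields a unique increasing chain in [x,y], and it is
-- lexicographically first.
module Submission where

open import Defs
open import Data.Nat as ℕ using (ℕ; z≤n; s≤s)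
import Data.Nat.Properties as ℕ
open import Data.Nat.Induction using (<-wellFounded)
open import Data.Fin using (Fin; zero; suc; _≟_; _<_; _≤_)
import Data.Fin.Properties as Fin
open import Data.Fin.Subset using (Subset; _⊂_; ∣_∣) renaming (_∈_ to _∈ₛ_)
open import Data.Fin.Subset.Properties using (p⊂q⇒∣p∣<∣q∣)
open import Data.Bool using (Bool; true; false; if_then_else_)
import Data.Bool as Bool
import Data.Bool.Properties as Bool
open import Data.Vec using (lookup; tabulate)
open import Data.Vec.Properties using (lookup∘tabulate; tabulate∘lookup; tabulate-cong; ≡-dec; []=⇒lookup; lookup⇒[]=)
open import Data.List using ([]; _∷_)
open import Data.List.Membership.Propositional using (_∈_)
open import Data.List.Relation.Unary.All using (All; []; _∷_)
import Data.List.Relation.Unary.All as All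
open import Data.List.Relation.Unary.Any using (here; there)
open import Data.Product using (∃; _×_; _,_; proj₁; proj₂)
import Data.Product as Product
import Data.Product.Properties as Product
open import Data.Sum as Sum using (_⊎_; inj₁; inj₂)
open import Data.Unit using (tt)
open import Data.Empty using (⊥-elim)
open import Function using (id; _∘_)
open import Induction.WellFounded using (Acc; acc)
open import Relation.Nullary using (¬_; Dec; yes; no; does; proof; ¬?)
open import Relation.Nullary.Decidable using (_×-dec_; dec-true; dec-false)
open import Relation.Nullary.Reflects using (Reflects; ofʸ; ofⁿ)
open import Relation.Unary using (Decidable)
open import Relation.Binary.PropositionalEquality
open ≡-Reasoning

private
  variable
    n : ℕ
    x y z w w′ : Raw n
    i j : Fin n
    ℓ : Label n
    s c : Steps n

least-witness : {P : Fin n → Set} → Decidable P → ∃ P → ∃ λ i → P i × (∀ {j} → P j → i ≤ j)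
least-witness {n = ℕ.suc n} P? witness with P? zero
... | yes P0 = zero , P0 , λ _ → z≤n
... | no ¬P0 with witness
...   | zero , P0 = ⊥-elim (¬P0 P0)
...   | suc i , Pi with least-witness (P? ∘ suc) (i , Pi)
...     | m , Pm , m-least = suc m , Pm , λ { {zero} P0 → ⊥-elim (¬P0 P0) ; {suc j} Pj → s≤s (m-least Pj) }

lookup-ext : (∀ i → lookup x i ≡ lookup y i) → x ≡ y
lookup-ext {x = x} {y = y} eq = trans (sym (tabulate∘lookup x)) (trans (tabulate-cong eq) (tabulate∘lookup y))

module _ (x : Raw n) (p q : Fin n) where

  lookup-merge : ∀ i → lookup (merge x p q) i ≡ (if does (lookup x i ≟ q) then p else lookup x i)
  lookup-merge = lookup∘tabulate _

  merge-removed : lookup x i ≡ q → lookup (merge x p q) i ≡ p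
  merge-removed {i} xi≡q rewrite lookup-merge i | dec-true (lookup x i ≟ q) xi≡q = refl

  merge-other : lookup x i ≢ q → lookup (merge x p q) i ≡ lookup x i
  merge-other {i} xi≢q rewrite lookup-merge i | dec-false (lookup x i ≟ q) xi≢q = refl

  merge-coarsens : lookup x i ≡ lookup x j → lookup (merge x p q) i ≡ lookup (merge x p q) j
  merge-coarsens {i} {j} xi≡xj rewrite lookup-merge i | lookup-merge j | xi≡xj = refl

  merge-moves : lookup (merge x p q) i ≢ lookup x i → lookup x i ≡ q
  merge-moves {i} moved with lookup x i ≟ q
  ... | yes xi≡q = xi≡q
  ... | no xi≢q = ⊥-elim (moved (merge-other xi≢q))

  merge-joins : lookup (merge x p q) i ≡ lookup (merge x p q) j → lookup x i ≢ lookup x j →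
    (lookup x i ≡ p × lookup x j ≡ q) ⊎ (lookup x i ≡ q × lookup x j ≡ p)
  merge-joins {i} {j} joined apart with lookup x i ≟ q | lookup x j ≟ q
  ... | yes xi≡q | yes xj≡q = ⊥-elim (apart (trans xi≡q (sym xj≡q)))
  ... | yes xi≡q | no xj≢q = inj₂ (xi≡q , trans (sym (merge-other xj≢q)) (trans (sym joined) (merge-removed xi≡q)))
  ... | no xi≢q | yes xj≡q = inj₁ (trans (sym (merge-other xi≢q)) (trans joined (merge-removed xj≡q)) , xj≡q)
  ... | no xi≢q | no xj≢q = ⊥-elim (apart (trans (sym (merge-other xi≢q)) (trans joined (merge-other xj≢q))))

Refines : Raw n → Raw n → Set
Refines x y = ∀ {i j} → lookup x i ≡ lookup x j → lookup y i ≡ lookup y j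

-- The order of Π•ₙ on encodings: every y-block is a union of x-blocks, and its point is the point of one of them.
record _⊑_ (x y : Raw n) : Set where
  field
    coarsens : ∀ i → lookup y (lookup x i) ≡ lookup y i
    keeps-points : ∀ i → IsPoint x (lookup y i)
    pointed : IsPointedPartition y
open _⊑_

⊑-refl : IsPointedPartition x → x ⊑ x
⊑-refl px = record { coarsens = px ; keeps-points = px ; pointed = px }

⊑-refines : x ⊑ y → Refines x y
⊑-refines {x = x} {y = y} x⊑y {i} {j} xi≡xj = begin
  lookup y i             ≡⟨ coarsens x⊑y i ⟨
  lookup y (lookup x i)  ≡⟨ cong (lookup y) xi≡xj ⟩
  lookup y (lookup x j)  ≡⟨ coarsens x⊑y j ⟩
  lookup y j             ∎

module _ (x : Raw n) {p q : Fin n} (px : IsPointedPartition x) (pp : IsPoint x p) (pq : IsPoint x q) (p≢q : p ≢ q) where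

  merge-pointed : IsPointedPartition (merge x p q)
  merge-pointed i with lookup x i ≟ q
  ... | yes xi≡q = begin
    lookup (merge x p q) (lookup (merge x p q) i)  ≡⟨ cong (lookup (merge x p q)) (merge-removed x p q xi≡q) ⟩
    lookup (merge x p q) p                         ≡⟨ merge-other x p q (p≢q ∘ trans (sym pp)) ⟩
    lookup x p                                     ≡⟨ pp ⟩
    p                                              ≡⟨ merge-removed x p q xi≡q ⟨
    lookup (merge x p q) i                         ∎
  ... | no xi≢q = begin
    lookup (merge x p q) (lookup (merge x p q) i)  ≡⟨ cong (lookup (merge x p q)) (merge-other x p q xi≢q) ⟩
    lookup (merge x p q) (lookup x i)              ≡⟨ merge-coarsens x p q (px i) ⟩
    lookup (merge x p q) i                         ∎

  merge-points : IsPoint (merge x p q) i → IsPoint x i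
  merge-points {i} zi≡i with lookup x i ≟ q
  ... | yes xi≡q = trans (cong (lookup x) i≡p) (trans pp (sym i≡p))
    where i≡p = trans (sym zi≡i) (merge-removed x p q xi≡q)
  ... | no xi≢q = trans (sym (merge-other x p q xi≢q)) zi≡i

  merge-unpoints : ¬ IsPoint (merge x p q) q
  merge-unpoints zq≡q = p≢q (trans (sym (merge-removed x p q pq)) zq≡q)

  ⊑-merge : x ⊑ y → lookup y p ≡ lookup y q → lookup y q ≢ q → merge x p q ⊑ y
  ⊑-merge {y = y} x⊑y yp≡yq yq≢q =
    record { coarsens = coarsens′ ; keeps-points = keeps-points′ ; pointed = pointed x⊑y }
    where
    coarsens′ : ∀ i → lookup y (lookup (merge x p q) i) ≡ lookup y i
    coarsens′ i with lookup x i ≟ q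
    ... | yes xi≡q = begin
      lookup y (lookup (merge x p q) i)  ≡⟨ cong (lookup y) (merge-removed x p q xi≡q) ⟩
      lookup y p                         ≡⟨ yp≡yq ⟩
      lookup y q                         ≡⟨ cong (lookup y) xi≡q ⟨
      lookup y (lookup x i)              ≡⟨ coarsens x⊑y i ⟩
      lookup y i                         ∎
    ... | no xi≢q = trans (cong (lookup y) (merge-other x p q xi≢q)) (coarsens x⊑y i)

    yi≢q : ∀ i → lookup y i ≢ q
    yi≢q i yi≡q = yq≢q (trans (cong (lookup y) (sym yi≡q)) (trans (pointed x⊑y i) yi≡q))

    keeps-points′ : ∀ i → IsPoint (merge x p q) (lookup y i)
    keeps-points′ i = trans (merge-other x p q (yi≢q i ∘ trans (sym (keeps-points x⊑y i)))) (keeps-points x⊑y i)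

  merge-⊑ : merge x p q ⊑ y → x ⊑ y
  merge-⊑ {y = y} z⊑y =
    record { coarsens = coarsens′ ; keeps-points = merge-points ∘ keeps-points z⊑y ; pointed = pointed z⊑y }
    where
    coarsens′ : ∀ i → lookup y (lookup x i) ≡ lookup y i
    coarsens′ i = begin
      lookup y (lookup x i)                          ≡⟨ coarsens z⊑y (lookup x i) ⟨
      lookup y (lookup (merge x p q) (lookup x i))   ≡⟨ cong (lookup y) (merge-coarsens x p q (px i)) ⟩
      lookup y (lookup (merge x p q) i)              ≡⟨ coarsens z⊑y i ⟩
      lookup y i                                     ∎

  merge-⊑-removed : merge x p q ⊑ y → lookup y q ≢ q
  merge-⊑-removed {y = y} z⊑y yq≡q =
    merge-unpoints (trans (cong (lookup (merge x p q)) (sym yq≡q)) (trans (keeps-points z⊑y q) yq≡q))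

lo hi kept removed : Label n → Fin n
lo (c , _ , _) = c
hi (_ , d , _) = d
kept (c , _ , true) = c
kept (_ , d , false) = d
removed (_ , d , true) = d
removed (c , _ , false) = c

mergeAt : Raw n → Label n → Raw n
mergeAt x ℓ = merge x (lookup x (kept ℓ)) (lookup x (removed ℓ))

IsBlockMin : Raw n → Fin n → Set
IsBlockMin x i = ∀ {j} → lookup x j ≡ lookup x i → i ≤ j

block-min-unique : (x : Raw n) → IsBlockMin x i → IsBlockMin x j → lookup x i ≡ lookup x j → i ≡ j
block-min-unique x i-min j-min xi≡xj = Fin.≤-antisym (i-min (sym xi≡xj)) (j-min xi≡xj)

record Cover (x : Raw n) (ℓ : Label n) (z : Raw n) : Set where
  field
    lo<hi : lo ℓ < hi ℓ
    lo-min : IsBlockMin x (lo ℓ)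
    hi-min : IsBlockMin x (hi ℓ)
    apart : lookup x (lo ℓ) ≢ lookup x (hi ℓ)
    target : z ≡ mergeAt x ℓ
open Cover

LCover→Cover : (x : Raw n) → LCover x ℓ z → Cover x ℓ z
LCover→Cover x (p , q , a , b , _ , _ , p≢q , (xa≡p , a-min) , (xb≡q , b-min) , refl , inj₁ (a<b , refl)) = record
  { lo<hi = a<b ; lo-min = a-min _ ∘ λ e → trans e xa≡p ; hi-min = b-min _ ∘ λ e → trans e xb≡q
  ; apart = λ e → p≢q (trans (sym xa≡p) (trans e xb≡q)) ; target = cong₂ (merge x) (sym xa≡p) (sym xb≡q) }
LCover→Cover x (p , q , a , b , _ , _ , p≢q , (xa≡p , a-min) , (xb≡q , b-min) , refl , inj₂ (b<a , refl)) = record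
  { lo<hi = b<a ; lo-min = b-min _ ∘ λ e → trans e xb≡q ; hi-min = a-min _ ∘ λ e → trans e xa≡p
  ; apart = λ e → p≢q (trans (sym xa≡p) (trans (sym e) xb≡q)) ; target = cong₂ (merge x) (sym xa≡p) (sym xb≡q) }

Cover→LCover : IsPointedPartition x → Cover x ℓ z → LCover x ℓ z
Cover→LCover {x = x} {ℓ = c , d , true} px C =
  lookup x c , lookup x d , c , d , px c , px d , apart C ,
  (refl , λ _ → lo-min C) , (refl , λ _ → hi-min C) , target C , inj₁ (lo<hi C , refl)
Cover→LCover {x = x} {ℓ = c , d , false} px C =
  lookup x d , lookup x c , d , c , px d , px c , apart C ∘ sym ,
  (refl , λ _ → hi-min C) , (refl , λ _ → lo-min C) , target C , inj₂ (lo<hi C , refl)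

kept-apart : Cover x ℓ z → lookup x (kept ℓ) ≢ lookup x (removed ℓ)
kept-apart {ℓ = _ , _ , true} C = apart C
kept-apart {ℓ = _ , _ , false} C = apart C ∘ sym

kept-min : Cover x ℓ z → IsBlockMin x (kept ℓ)
kept-min {ℓ = _ , _ , true} C = lo-min C
kept-min {ℓ = _ , _ , false} C = hi-min C

removed-min : Cover x ℓ z → IsBlockMin x (removed ℓ)
removed-min {ℓ = _ , _ , true} C = hi-min C
removed-min {ℓ = _ , _ , false} C = lo-min C

kept-removed⇒lo-hi : ∀ ℓ → (i ≡ kept ℓ × j ≡ removed ℓ) ⊎ (i ≡ removed ℓ × j ≡ kept ℓ) →
  (i ≡ lo ℓ × j ≡ hi ℓ) ⊎ (i ≡ hi ℓ × j ≡ lo ℓ)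
kept-removed⇒lo-hi (_ , _ , true) = id
kept-removed⇒lo-hi (_ , _ , false) = Sum.swap

cover-pointed : IsPointedPartition x → Cover x ℓ z → IsPointedPartition z
cover-pointed {x = x} {ℓ = ℓ} px C rewrite target C = merge-pointed x px (px (kept ℓ)) (px (removed ℓ)) (kept-apart C)

cover-refines : Cover x ℓ z → Refines x z
cover-refines {x = x} {ℓ = ℓ} C rewrite target C = merge-coarsens x (lookup x (kept ℓ)) (lookup x (removed ℓ))

cover-joins : Cover x ℓ z → lookup z (lo ℓ) ≡ lookup z (hi ℓ)
cover-joins {x = x} {ℓ = c , d , true} C rewrite target C =
  trans (merge-other x (lookup x c) (lookup x d) (apart C)) (sym (merge-removed x (lookup x c) (lookup x d) refl))
cover-joins {x = x} {ℓ = c , d , false} C rewrite target C =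
  trans (merge-removed x (lookup x d) (lookup x c) refl) (sym (merge-other x (lookup x d) (lookup x c) (apart C ∘ sym)))

cover-⊑ : IsPointedPartition x → Cover x ℓ z → z ⊑ y → x ⊑ y
cover-⊑ {x = x} {ℓ = ℓ} px C rewrite target C = merge-⊑ x px (px (kept ℓ)) (px (removed ℓ)) (kept-apart C)

cover-same-block : Cover x ℓ z → z ⊑ y → lookup y (lo ℓ) ≡ lookup y (hi ℓ)
cover-same-block C z⊑y = ⊑-refines z⊑y (cover-joins C)

cover-removed-moves : IsPointedPartition x → Cover x ℓ z → z ⊑ y → lookup x (removed ℓ) ≢ lookup y (removed ℓ)
cover-removed-moves {x = x} {ℓ = ℓ} {y = y} px C z⊑y xr≡yr =
  removed-not-point (trans (coarsens (cover-⊑ px C z⊑y) (removed ℓ)) (sym xr≡yr))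
  where
  removed-not-point : lookup y (lookup x (removed ℓ)) ≢ lookup x (removed ℓ)
  removed-not-point rewrite target C = merge-⊑-removed x px (px (kept ℓ)) (px (removed ℓ)) (kept-apart C) z⊑y

cover-moved-block : Cover x ℓ z → lookup z i ≢ lookup x i → IsBlockMin x i → i ≡ removed ℓ
cover-moved-block {x = x} {ℓ = ℓ} C moved i-min rewrite target C =
  block-min-unique x i-min (removed-min C) (merge-moves x (lookup x (kept ℓ)) (lookup x (removed ℓ)) moved)

cover-joined-ends : Cover x ℓ z → lookup z i ≡ lookup z j → lookup x i ≢ lookup x j →
  IsBlockMin x i → IsBlockMin x j → (i ≡ kept ℓ × j ≡ removed ℓ) ⊎ (i ≡ removed ℓ × j ≡ kept ℓ)
cover-joined-ends {x = x} {ℓ = ℓ} C joined apart′ i-min j-min rewrite target C =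
  Sum.map (Product.map (block-min-unique x i-min (kept-min C)) (block-min-unique x j-min (removed-min C)))
          (Product.map (block-min-unique x i-min (removed-min C)) (block-min-unique x j-min (kept-min C)))
          (merge-joins x (lookup x (kept ℓ)) (lookup x (removed ℓ)) joined apart′)

cover-joined-blocks : Cover x ℓ z → lookup z i ≡ lookup z j → lookup x i ≢ lookup x j →
  IsBlockMin x i → IsBlockMin x j → i < j → lo ℓ ≡ i × hi ℓ ≡ j
cover-joined-blocks {ℓ = ℓ@(_ , _ , _)} C joined apart′ i-min j-min i<j
  with kept-removed⇒lo-hi ℓ (cover-joined-ends C joined apart′ i-min j-min)
... | inj₁ (refl , refl) = refl , refl
... | inj₂ (refl , refl) = ⊥-elim (Fin.<-asym (lo<hi C) i<j)

pointSet : Raw n → Subset n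
pointSet x = tabulate λ i → does (lookup x i ≟ i)

lookup-pointSet : (x : Raw n) (i : Fin n) → lookup (pointSet x) i ≡ does (lookup x i ≟ i)
lookup-pointSet x = lookup∘tabulate _

point∈pointSet : IsPoint x i → i ∈ₛ pointSet x
point∈pointSet {x = x} {i = i} xi≡i = lookup⇒[]= i _ (trans (lookup-pointSet x i) (dec-true (lookup x i ≟ i) xi≡i))

∈pointSet⇒point : i ∈ₛ pointSet x → IsPoint x i
∈pointSet⇒point {i = i} {x = x} i∈ with lookup x i ≟ i | trans (sym (lookup-pointSet x i)) ([]=⇒lookup i∈)
... | yes xi≡i | _ = xi≡i
... | no _ | ()

cover-shrinks-points : IsPointedPartition x → Cover x ℓ z → pointSet z ⊂ pointSet x
cover-shrinks-points {x = x} {ℓ = ℓ} px C rewrite target C =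
  point∈pointSet {x = x} ∘ merge-points x px pk pr (kept-apart C) ∘ ∈pointSet⇒point {x = mergeAt x ℓ} ,
  lookup x (removed ℓ) , point∈pointSet {x = x} pr ,
  merge-unpoints x px pk pr (kept-apart C) ∘ ∈pointSet⇒point {x = mergeAt x ℓ}
  where
  pk = px (kept ℓ)
  pr = px (removed ℓ)

_≟Λ_ : (ℓ ℓ′ : Label n) → Dec (ℓ ≡ ℓ′)
_≟Λ_ = Product.≡-dec _≟_ (Product.≡-dec _≟_ Bool._≟_)

≤Λ-refl : (ℓ : Label n) → ℓ ≤Λ ℓ
≤Λ-refl _ = inj₂ (refl , Fin.≤-refl , Bool.≤-refl)

≤Λ-trans : ∀ {ℓ₁ ℓ₂ ℓ₃ : Label n} → ℓ₁ ≤Λ ℓ₂ → ℓ₂ ≤Λ ℓ₃ → ℓ₁ ≤Λ ℓ₃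
≤Λ-trans (inj₁ a<b) (inj₁ b<c) = inj₁ (Fin.<-trans a<b b<c)
≤Λ-trans (inj₁ a<b) (inj₂ (refl , _)) = inj₁ a<b
≤Λ-trans (inj₂ (refl , _)) (inj₁ b<c) = inj₁ b<c
≤Λ-trans (inj₂ (refl , b≤b′ , u≤u′)) (inj₂ (refl , b′≤b″ , u′≤u″)) =
  inj₂ (refl , Fin.≤-trans b≤b′ b′≤b″ , Bool.≤-trans u≤u′ u′≤u″)

≤Λ-flag : ∀ {a b d : Fin n} {u v} → (a , b , u) ≤Λ (a , d , v) → u Bool.≤ v
≤Λ-flag (inj₁ a<a) = ⊥-elim (Fin.<-irrefl refl a<a)
≤Λ-flag (inj₂ (_ , _ , u≤v)) = u≤v

≤Λ-pinned : ∀ {a b : Fin n} {u v} → (a , b , u) ≤Λ ℓ → ℓ ≤Λ (a , b , v) →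
  ∃ λ w → ℓ ≡ (a , b , w) × u Bool.≤ w
≤Λ-pinned (inj₁ a<c) (inj₁ c<a) = ⊥-elim (Fin.<-asym a<c c<a)
≤Λ-pinned (inj₁ a<a) (inj₂ (refl , _)) = ⊥-elim (Fin.<-irrefl refl a<a)
≤Λ-pinned (inj₂ (refl , _)) (inj₁ a<a) = ⊥-elim (Fin.<-irrefl refl a<a)
≤Λ-pinned (inj₂ (refl , b≤d , u≤w)) (inj₂ (_ , d≤b , _)) =
  _ , cong (λ d → _ , d , _) (Fin.≤-antisym d≤b b≤d) , u≤w

Increasing-tail : ∀ {ls} → Increasing (ℓ ∷ ls) → Increasing ls
Increasing-tail {ls = []} _ = tt
Increasing-tail {ls = _ ∷ _} (_ , inc) = inc

Increasing⇒head-least : ∀ {ls} → Increasing (ℓ ∷ ls) → All (ℓ ≤Λ_) (ℓ ∷ ls)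
Increasing⇒head-least {ℓ = ℓ} {ls = []} _ = ≤Λ-refl ℓ ∷ []
Increasing⇒head-least {ℓ = ℓ} {ls = _ ∷ _} ((ℓ≤ℓ′ , _) , inc) =
  ≤Λ-refl ℓ ∷ All.map (≤Λ-trans ℓ≤ℓ′) (Increasing⇒head-least inc)

LexPrecedes-head : ∀ {ℓ′ ls ls′} → ℓ <Λ ℓ′ → LexPrecedes (ℓ ∷ ls) (ℓ′ ∷ ls′)
LexPrecedes-head ℓ<ℓ′ = [] , _ , _ , _ , _ , refl , refl , ℓ<ℓ′

LexPrecedes-∷ : ∀ {ls ls′} → LexPrecedes ls ls′ → LexPrecedes (ℓ ∷ ls) (ℓ ∷ ls′)
LexPrecedes-∷ {ℓ = ℓ} (pre , l , l′ , r , r′ , refl , refl , l<l′) =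
  ℓ ∷ pre , l , l′ , r , r′ , refl , refl , l<l′

head-cover : (x : Raw n) → IsMaxChain x y ((ℓ , z) ∷ s) → Cover x ℓ z
head-cover x = LCover→Cover x ∘ proj₁

chain⇒⊑ : (x : Raw n) → IsPointedPartition x → IsMaxChain x y s → x ⊑ y
chain⇒⊑ {s = []} x px refl = ⊑-refl px
chain⇒⊑ {s = (_ , z) ∷ _} x px (cov , chain) = cover-⊑ px C (chain⇒⊑ z (cover-pointed px C) chain)
  where C = LCover→Cover x cov

head-⊑ : (x : Raw n) → IsPointedPartition x → IsMaxChain x y ((ℓ , z) ∷ s) → z ⊑ y
head-⊑ x px (cov , chain) = chain⇒⊑ _ (cover-pointed px (LCover→Cover x cov)) chain

no-loop : IsPointedPartition x → ¬ IsMaxChain x x ((ℓ , z) ∷ s)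
no-loop {x = x} px chain = cover-removed-moves px (head-cover x chain) (head-⊑ x px chain) refl

IsELChain : Raw n → Raw n → Steps n → Set
IsELChain {n} x y c = IsMaxChain x y c × Increasing (labels c) ×
  (∀ (c′ : Steps n) → IsMaxChain x y c′ → Increasing (labels c′) → c′ ≡ c) ×
  (∀ (c′ : Steps n) → IsMaxChain x y c′ → c′ ≢ c → LexPrecedes (labels c) (labels c′))

IsELChain-[] : IsPointedPartition x → IsELChain x x []
IsELChain-[] {x = x} px = refl , tt , unique , lex
  where
  unique : ∀ c′ → IsMaxChain x x c′ → Increasing (labels c′) → c′ ≡ []
  unique [] _ _ = refl
  unique (_ ∷ _) chain _ = ⊥-elim (no-loop px chain)

  lex : ∀ c′ → IsMaxChain x x c′ → c′ ≢ [] → LexPrecedes [] (labels c′)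
  lex [] _ c′≢[] = ⊥-elim (c′≢[] refl)
  lex (_ ∷ _) chain _ = ⊥-elim (no-loop px chain)

IsELChain-∷ : ∀ {ℓ₀ z₀ c₀} → LCover x ℓ₀ z₀ → x ≢ y →
  (∀ {ℓ z s} → IsMaxChain x y ((ℓ , z) ∷ s) → ℓ₀ ≤Λ ℓ) →
  (∀ {ℓ w s} → IsMaxChain z₀ y ((ℓ , w) ∷ s) → ℓ₀ <Λ ℓ) →
  (∀ {ℓ z s} → IsMaxChain x y ((ℓ , z) ∷ s) → Increasing (ℓ ∷ labels s) → ℓ ≡ ℓ₀) →
  IsELChain z₀ y c₀ → IsELChain x y ((ℓ₀ , z₀) ∷ c₀)
IsELChain-∷ {x = x} {y = y} {ℓ₀ = ℓ₀} {z₀ = z₀} {c₀ = c₀} cover₀ x≢y first-above next-above increasing-first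
            (chain₀ , inc₀ , unique₀ , lex₀) =
  (cover₀ , chain₀) , prepend chain₀ inc₀ , unique , lex
  where
  same-target : LCover x ℓ₀ z → z ≡ z₀
  same-target cov = trans (target (LCover→Cover x cov)) (sym (target (LCover→Cover x cover₀)))

  prepend : ∀ {c} → IsMaxChain z₀ y c → Increasing (labels c) → Increasing (ℓ₀ ∷ labels c)
  prepend {[]} _ _ = tt
  prepend {_ ∷ _} chain inc = next-above chain , inc

  unique : ∀ c′ → IsMaxChain x y c′ → Increasing (labels c′) → c′ ≡ (ℓ₀ , z₀) ∷ c₀
  unique [] x≡y _ = ⊥-elim (x≢y x≡y)
  unique ((ℓ , z) ∷ s) chain@(cov , chain′) inc with increasing-first chain inc
  ... | refl with same-target cov
  ...   | refl = cong ((ℓ₀ , z₀) ∷_) (unique₀ s chain′ (Increasing-tail inc))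

  lex : ∀ c′ → IsMaxChain x y c′ → c′ ≢ (ℓ₀ , z₀) ∷ c₀ → LexPrecedes (ℓ₀ ∷ labels c₀) (labels c′)
  lex [] x≡y _ = ⊥-elim (x≢y x≡y)
  lex ((ℓ , z) ∷ s) chain@(cov , chain′) c′≢ with ℓ ≟Λ ℓ₀
  ... | no ℓ≢ℓ₀ = LexPrecedes-head (first-above chain , ℓ≢ℓ₀ ∘ sym)
  ... | yes refl with same-target cov
  ...   | refl = LexPrecedes-∷ (lex₀ s chain′ (c′≢ ∘ cong ((ℓ₀ , z₀) ∷_)))

Joins : Raw n → Raw n → Fin n → Fin n → Set
Joins x y i j = lookup y j ≡ lookup y i × lookup x j ≢ lookup x i

Joins? : (x y : Raw n) (i j : Fin n) → Dec (Joins x y i j)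
Joins? x y i j = (lookup y j ≟ lookup y i) ×-dec ¬? (lookup x j ≟ lookup x i)

record FirstJoin (x y : Raw n) : Set where
  field
    m₁ m₂ : Fin n
    joins : Joins x y m₁ m₂
    m₁-least : ∀ {i j} → Joins x y i j → m₁ ≤ i
    m₂-least : ∀ {j} → Joins x y m₁ j → m₂ ≤ j

moved-joins : x ⊑ y → lookup x i ≢ lookup y i → Joins x y i (lookup y i)
moved-joins {i = i} x⊑y xi≢yi = pointed x⊑y i , xi≢yi ∘ sym ∘ trans (sym (keeps-points x⊑y i))

firstJoin : x ⊑ y → x ≢ y → FirstJoin x y
firstJoin {x = x} {y = y} x⊑y x≢y
  with Fin.¬∀⟶∃¬ _ (λ i → lookup x i ≡ lookup y i) (λ i → lookup x i ≟ lookup y i) (x≢y ∘ lookup-ext)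
... | i , xi≢yi
  with least-witness (λ i → Fin.any? (Joins? x y i)) (i , _ , moved-joins x⊑y xi≢yi)
... | m₁ , (j , m₁-joins-j) , m₁-least
  with least-witness (Joins? x y m₁) (j , m₁-joins-j)
... | m₂ , joins , m₂-least = record
  { m₁ = m₁ ; m₂ = m₂ ; joins = joins ; m₁-least = λ i-joins-j → m₁-least (_ , i-joins-j) ; m₂-least = m₂-least }

module FirstMerge {x y : Raw n} (px : IsPointedPartition x) (x⊑y : x ⊑ y) (J : FirstJoin x y) where
  open FirstJoin J public

  t : Fin n
  t = lookup y m₁

  apart₁₂ : lookup x m₁ ≢ lookup x m₂
  apart₁₂ = proj₂ joins ∘ sym

  m₁-least-in-block : lookup y j ≡ t → m₁ ≤ j
  m₁-least-in-block {j} yj≡t with lookup x j ≟ lookup x m₁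
  ... | yes xj≡xm₁ =
    m₁-least (trans (proj₁ joins) (sym yj≡t) , λ xm₂≡xj → proj₂ joins (trans xm₂≡xj xj≡xm₁))
  ... | no xj≢xm₁ = m₁-least (sym yj≡t , xj≢xm₁ ∘ sym)

  m₁<m₂ : m₁ < m₂
  m₁<m₂ = Fin.≤∧≢⇒< (m₁-least-in-block (proj₁ joins)) (apart₁₂ ∘ cong (lookup x))

  m₁-min : w ⊑ y → IsBlockMin w m₁
  m₁-min w⊑y wj≡wm₁ = m₁-least-in-block (⊑-refines w⊑y wj≡wm₁)

  m₂-min : Refines x w → w ⊑ y → lookup w m₁ ≢ lookup w m₂ → IsBlockMin w m₂
  m₂-min x≼w w⊑y apart′ wj≡wm₂ =
    m₂-least (trans (⊑-refines w⊑y wj≡wm₂) (proj₁ joins) ,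
              λ xj≡xm₁ → apart′ (trans (sym (x≼w xj≡xm₁)) wj≡wm₂))

  first-cover : ∀ u → Cover x (m₁ , m₂ , u) (mergeAt x (m₁ , m₂ , u))
  first-cover u = record
    { lo<hi = m₁<m₂ ; lo-min = m₁-min x⊑y ; hi-min = m₂-min id x⊑y apart₁₂ ; apart = apart₁₂ ; target = refl }

  y-m₁-point : lookup y (lookup x m₁) ≡ t
  y-m₁-point = coarsens x⊑y m₁

  y-m₂-point : lookup y (lookup x m₂) ≡ t
  y-m₂-point = trans (coarsens x⊑y m₂) (proj₁ joins)

  first-⊑ : ∀ {u} → Reflects (lookup x m₁ ≡ t) u → mergeAt x (m₁ , m₂ , u) ⊑ y
  first-⊑ (ofʸ xm₁≡t) = ⊑-merge x px (px m₁) (px m₂) apart₁₂ x⊑y (trans y-m₁-point (sym y-m₂-point))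
    λ yxm₂≡xm₂ → apart₁₂ (trans xm₁≡t (trans (sym y-m₂-point) yxm₂≡xm₂))
  first-⊑ (ofⁿ xm₁≢t) = ⊑-merge x px (px m₂) (px m₁) (apart₁₂ ∘ sym) x⊑y (trans y-m₂-point (sym y-m₁-point))
    λ yxm₁≡xm₁ → xm₁≢t (trans (sym yxm₁≡xm₁) y-m₁-point)

  first-keeps-m₁ : ∀ {u} → Reflects (lookup x m₁ ≡ t) u → lookup x m₁ ≡ t →
    lookup (mergeAt x (m₁ , m₂ , u)) m₁ ≡ t
  first-keeps-m₁ (ofʸ _) xm₁≡t = trans (merge-other x (lookup x m₁) (lookup x m₂) apart₁₂) xm₁≡t
  first-keeps-m₁ (ofⁿ xm₁≢t) xm₁≡t = ⊥-elim (xm₁≢t xm₁≡t)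

  cover-Joins : Refines x w → Cover w ℓ w′ → w′ ⊑ y → Joins x y (lo ℓ) (hi ℓ)
  cover-Joins x≼w C w′⊑y = sym (cover-same-block C w′⊑y) , λ xhi≡xlo → apart C (x≼w (sym xhi≡xlo))

  label-bound : ∀ {u} → Reflects (lookup x m₁ ≡ t) u → IsPointedPartition w → Refines x w →
    (lookup x m₁ ≡ t → lookup w m₁ ≡ t) → Cover w ℓ w′ → w′ ⊑ y → (m₁ , m₂ , u) ≤Λ ℓ
  label-bound {w = w} {ℓ = c , d , v} {w′ = w′} u-spec pw x≼w keeps C w′⊑y
    with m₁ ≟ c | cover-Joins x≼w C w′⊑y
  ... | no m₁≢c | c-joins-d = inj₁ (Fin.≤∧≢⇒< (m₁-least c-joins-d) m₁≢c)
  ... | yes refl | c-joins-d = inj₂ (refl , m₂-least c-joins-d , flag-bound u-spec C)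
    where
    flag-bound : ∀ {u v} → Reflects (lookup x m₁ ≡ t) u → Cover w (m₁ , d , v) w′ → u Bool.≤ v
    flag-bound (ofⁿ _) _ = Bool.≤-minimum _
    flag-bound {v = true} (ofʸ _) _ = Bool.≤-refl
    flag-bound {v = false} (ofʸ xm₁≡t) C′ = ⊥-elim (cover-removed-moves pw C′ w′⊑y (keeps xm₁≡t))

  chain-joins : (w : Raw n) → IsPointedPartition w → Refines x w → IsMaxChain w y s →
    lookup w m₁ ≢ lookup w m₂ → ∃ λ v → (m₁ , m₂ , v) ∈ labels s
  chain-joins {s = []} w _ _ refl apart′ = ⊥-elim (apart′ (sym (proj₁ joins)))
  chain-joins {s = ((c , d , v) , z) ∷ s} w pw x≼w chain@(cov , chain′) apart′
    with lookup z m₁ ≟ lookup z m₂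
  ... | no apart″ = Product.map₂ there (chain-joins z (cover-pointed pw C) (cover-refines C ∘ x≼w) chain′ apart″)
    where
    C : Cover w (c , d , v) z
    C = LCover→Cover w cov
  ... | yes joined
    with cover-joined-blocks (LCover→Cover w cov) joined apart′ (m₁-min w⊑y) (m₂-min x≼w w⊑y apart′) m₁<m₂
    where
    w⊑y : w ⊑ y
    w⊑y = chain⇒⊑ w pw chain
  ...   | refl , refl = v , here refl

  moving-label : Cover w ℓ z → z ⊑ y → m₁ ≡ removed ℓ → ∃ λ d → ℓ ≡ (m₁ , d , false)
  moving-label {ℓ = c , d , false} _ _ refl = d , refl
  moving-label {ℓ = c , d , true} C z⊑y refl =
    ⊥-elim (ℕ.<⇒≱ (lo<hi C) (m₁-least-in-block (cover-same-block C z⊑y)))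

  chain-moves : (w : Raw n) → IsPointedPartition w → IsMaxChain w y s → lookup w m₁ ≢ t →
    ∃ λ d → (m₁ , d , false) ∈ labels s
  chain-moves {s = []} w _ refl moved = ⊥-elim (moved refl)
  chain-moves {s = (ℓ , z) ∷ s} w pw chain@(cov , chain′) moved with lookup z m₁ ≟ lookup w m₁
  ... | yes same =
    Product.map₂ there (chain-moves z (cover-pointed pw (LCover→Cover w cov)) chain′ (moved ∘ trans (sym same)))
  ... | no changed
    with moving-label C (head-⊑ w pw chain) (cover-moved-block C changed (m₁-min (chain⇒⊑ w pw chain)))
    where
    C : Cover w ℓ z
    C = LCover→Cover w cov
  ...   | d , refl = d , here refl

  module _ {u : Bool} (u-spec : Reflects (lookup x m₁ ≡ t) u) where

    ℓ₀ : Label n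
    ℓ₀ = m₁ , m₂ , u

    z₀ : Raw n
    z₀ = mergeAt x ℓ₀

    first-above : IsMaxChain x y ((ℓ , z) ∷ s) → ℓ₀ ≤Λ ℓ
    first-above chain = label-bound u-spec px id id (head-cover x chain) (head-⊑ x px chain)

    next-above : IsMaxChain z₀ y ((ℓ , w) ∷ s) → ℓ₀ <Λ ℓ
    next-above {ℓ = ℓ} {w = w} chain =
      label-bound u-spec pz₀ (cover-refines C₀) (first-keeps-m₁ u-spec) C (head-⊑ z₀ pz₀ chain) ,
      λ { refl → apart C (cover-joins C₀) }
      where
      C₀ : Cover x ℓ₀ z₀
      C₀ = first-cover u
      pz₀ : IsPointedPartition z₀
      pz₀ = cover-pointed px C₀
      C : Cover z₀ ℓ w
      C = head-cover z₀ chain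

    increasing-first : IsMaxChain x y ((ℓ , z) ∷ s) → Increasing (ℓ ∷ labels s) → ℓ ≡ ℓ₀
    increasing-first chain inc
      with ≤Λ-pinned (first-above chain)
                     (All.lookup (Increasing⇒head-least inc) (proj₂ (chain-joins x px id chain apart₁₂)))
    ... | v , refl , u≤v = cong (λ b → m₁ , m₂ , b) (flag u-spec u≤v)
      where
      flag : ∀ {u} → Reflects (lookup x m₁ ≡ t) u → u Bool.≤ v → v ≡ u
      flag (ofʸ _) u≤v = sym (Bool.≤-antisym u≤v (Bool.≤-maximum v))
      flag (ofⁿ xm₁≢t) _ with chain-moves x px chain xm₁≢t
      ... | _ , moves = Bool.≤-antisym (≤Λ-flag (All.lookup (Increasing⇒head-least inc) moves)) (Bool.≤-minimum v)

    first-step : x ≢ y → IsELChain z₀ y c → IsELChain x y ((ℓ₀ , z₀) ∷ c)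
    first-step x≢y = IsELChain-∷ (Cover→LCover px (first-cover u)) x≢y first-above next-above increasing-first

el-chain : (x y : Raw n) → IsPointedPartition x → x ⊑ y → Acc ℕ._<_ ∣ pointSet x ∣ → ∃ (IsELChain x y)
el-chain x y px x⊑y (acc smaller) with ≡-dec _≟_ x y
... | yes refl = [] , IsELChain-[] px
... | no x≢y =
  let _ , el₀ = el-chain (z₀ u-spec) y (cover-pointed px C₀) (first-⊑ u-spec)
                         (smaller (p⊂q⇒∣p∣<∣q∣ (cover-shrinks-points px C₀)))
  in _ , first-step u-spec x≢y el₀
  where
  open FirstMerge px x⊑y (firstJoin x⊑y x≢y)
  u-spec : Reflects (lookup x m₁ ≡ t) (does (lookup x m₁ ≟ t))
  u-spec = proof (lookup x m₁ ≟ t)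
  C₀ : Cover x (ℓ₀ u-spec) (z₀ u-spec)
  C₀ = first-cover (does (lookup x m₁ ≟ t))

theorem2p14 : (n : ℕ) → 1 ℕ.≤ n → IsELLabeling•₂ n
theorem2p14 n _ x y px (s , chain) = el-chain x y px (chain⇒⊑ x px chain) (<-wellFounded _)
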